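{- Let $G$ be a finite connected graph, let $H$ be a subgraph of $G$ that is $P_3$-connected in $G$, and let $v\in V(G)$. Then at least one of the following holds: (1) there is a subgraph $H'$ of $G$ that is $P_3$-connected in $G$ with $H\subseteq H'$ (i.e. $V(H)\subseteq V(H')$ and $E(H)\subseteq E(H')$) and $v\in V(H')$; (2) there is a subgraph $H'$ of $G$ that is $P_3$-connected in $G$ with $v\in V(H')$ and containing a vertex $u\in V(H')$ such that $V(H)\subseteq V(H')$ and $uw\in E(H')$ for every $w\in V(H)$; (3) $v$ is adjacent to every vertex of $V(H)$.
   Context: Graphs are finite and simple. A subgraph $H$ of $G$ (not necessarily induced) is $P_3$-connected (in $G$) if $H$ is connected and for every two edges $e,f\in E(H)$ there is a sequence of edges $e=e_0,e_1,\dots,e_k=f$ of $H$ such that for each $0\le i\le k-1$, $e_i$ and $e_{i+1}$ are the two edges of an induced three-vertex path in $G$ (i.e. they share exactly one endpoint and their other endpoints are nonadjacent in $G$). -}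

module Defs where

open import Data.Nat using (ℕ)
open import Data.Fin using (Fin)
open import Data.Bool using (Bool; true; false)
open import Data.Product using (_×_; _,_; ∃)
open import Relation.Binary.PropositionalEquality using (_≡_; _≢_)
open import Relation.Binary.Construct.Closure.ReflexiveTransitive using (Star)

record Graph (n : ℕ) : Set where
  field
    adj     : Fin n → Fin n → Bool
    sym     : ∀ x y → adj x y ≡ adj y x
    irrefl  : ∀ x → adj x x ≡ false
open Graph public

Connected : ∀ {n} → Graph n → Set
Connected {n} G = (x y : Fin n) → Star (λ a b → adj G a b ≡ true) x y

record Subgraph {n : ℕ} (G : Graph n) : Set where
  field
    V      : Fin n → Bool
    E      : Fin n → Fin n → Bool
    E-sym  : ∀ x y → E x y ≡ E y x
    E-adj  : ∀ x y → E x y ≡ true → adj G x y ≡ true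
    E-V    : ∀ x y → E x y ≡ true → V x ≡ true
open Subgraph public

-- Edges represented as ordered pairs (x , y) with E x y; an edge and its
-- reversal represent the same edge.
EdgeOf : ∀ {n} {G : Graph n} → Subgraph G → Fin n × Fin n → Set
EdgeOf H (x , y) = E H x y ≡ true

-- One step in the edge sequence: either reorienting the same edge, or
-- moving from edge cp to edge cq of H, where c p q is an induced P3 in G.
data P3Step {n} {G : Graph n} (H : Subgraph G) : Fin n × Fin n → Fin n × Fin n → Set where
  flip : ∀ {x y} → E H x y ≡ true → P3Step H (x , y) (y , x)
  p3   : ∀ {c p q} → E H c p ≡ true → E H c q ≡ true → p ≢ q →
         adj G p q ≡ false → P3Step H (c , p) (c , q)

SubConnected : ∀ {n} {G : Graph n} → Subgraph G → Set
SubConnected {n} H =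
  ∃ (λ x → V H x ≡ true) ×
  ((x y : Fin n) → V H x ≡ true → V H y ≡ true → Star (λ a b → E H a b ≡ true) x y)

P3Connected : ∀ {n} {G : Graph n} → Subgraph G → Set
P3Connected {n} H =
  SubConnected H ×
  ((e f : Fin n × Fin n) → EdgeOf H e → EdgeOf H f → Star (P3Step H) e f)

_⊑_ : ∀ {n} {G : Graph n} → Subgraph G → Subgraph G → Set
_⊑_ {n} H H' =
  ((x : Fin n) → V H x ≡ true → V H' x ≡ true) ×
  ((x y : Fin n) → E H x y ≡ true → E H' x y ≡ true)

{-# OPTIONS --safe #-}
-- Walk from v towards H. If v has both a neighbour and a non-neighbour in a
-- P3-connected H, a walk in H between them crosses an edge zz' with z ~ v and
-- z' ≁ v, and adding the edge vz keeps P3-connectivity through the induced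
-- path v z z'. If v has no neighbour in H, apply induction to the next vertex x
-- of the walk: either x is absorbed into some H' (and v then joins H' as
-- before), or x dominates H, and the star centred at x with leaves V(H) ∪ {v}
-- is P3-connected because v is nonadjacent to every other leaf.
module Submission where

open import Defs
open import Data.Nat using (ℕ)
open import Data.Fin using (Fin; _≟_)
open import Data.Fin.Properties using (any?)
open import Data.Bool using (Bool; true; false; _∨_; _∧_)
open import Data.Bool.Properties using (∨-comm; ¬-not) renaming (_≟_ to _≟ᵇ_)
open import Data.Product using (_×_; Σ; ∃; ∃₂; _,_; proj₁; proj₂)
open import Data.Sum using (_⊎_; inj₁; inj₂; [_,_])
open import Data.Empty using (⊥-elim)
open import Function using (_∘_)
open import Relation.Nullary using (yes; no; does)
open import Relation.Nullary.Decidable using (_×-dec_; dec-true)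
open import Relation.Binary.PropositionalEquality
  using (_≡_; _≢_; refl; trans; cong₂) renaming (sym to ≡-sym)
open import Relation.Binary.Construct.Closure.ReflexiveTransitive
  using (Star; ε; _◅_; _◅◅_; map; reverse)

∨-true-elim : ∀ {a b} → a ∨ b ≡ true → a ≡ true ⊎ b ≡ true
∨-true-elim {true}  _ = inj₁ refl
∨-true-elim {false} p = inj₂ p

∨-trueˡ : ∀ {a} b → a ≡ true → a ∨ b ≡ true
∨-trueˡ _ refl = refl

∨-trueʳ : ∀ a {b} → b ≡ true → a ∨ b ≡ true
∨-trueʳ true  _ = refl
∨-trueʳ false p = p

∧-true-elim : ∀ {a b} → a ∧ b ≡ true → a ≡ true × b ≡ true
∧-true-elim {true} p = refl , p

∧-true-intro : ∀ {a b} → a ≡ true → b ≡ true → a ∧ b ≡ true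
∧-true-intro refl p = p

true≢false : ∀ {b} → b ≡ true → b ≢ false
true≢false refl ()

_==_ : ∀ {n} → Fin n → Fin n → Bool
x == y = does (x ≟ y)

==-sound : ∀ {n} {x y : Fin n} → x == y ≡ true → x ≡ y
==-sound {x = x} {y} p with x ≟ y
... | yes x≡y = x≡y
... | no  _   = ⊥-elim (true≢false p refl)

==-refl : ∀ {n} (x : Fin n) → x == x ≡ true
==-refl x = dec-true (x ≟ x) refl

Star-crossing : ∀ {A : Set} {R : A → A → Set} (p : A → Bool) {a b : A} →
  Star R a b → p a ≡ true → p b ≡ false →
  ∃₂ λ z z' → R z z' × p z ≡ true × p z' ≡ false
Star-crossing p ε pa pb = ⊥-elim (true≢false pa pb)
Star-crossing p {a} (_◅_ {j = c} r rs) pa pb with p c in pc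
... | true  = Star-crossing p rs pc pb
... | false = a , c , r , pa , pc

module _ {n : ℕ} (G : Graph n) where

  Walk : Subgraph G → Fin n → Fin n → Set
  Walk H = Star (λ a b → E H a b ≡ true)

  walk : ∀ {H : Subgraph G} {x y} → P3Connected H → V H x ≡ true → V H y ≡ true → Walk H x y
  walk pH = proj₂ (proj₁ pH) _ _

  p3-walk : ∀ {H : Subgraph G} {e f} → P3Connected H → EdgeOf H e → EdgeOf H f → Star (P3Step H) e f
  p3-walk pH = proj₂ pH _ _

  E-flip : ∀ (H : Subgraph G) {x y} → E H x y ≡ true → E H y x ≡ true
  E-flip H {x} {y} = trans (E-sym H y x)

  adj-sym : ∀ {x y} {b} → adj G x y ≡ b → adj G y x ≡ b
  adj-sym {x} {y} = trans (Graph.sym G y x)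

  P3Step-sym : ∀ {H : Subgraph G} {e f} → P3Step H e f → P3Step H f e
  P3Step-sym {H} (flip e) = flip (E-flip H e)
  P3Step-sym (p3 e f p≢q p≁q) = p3 f e (p≢q ∘ ≡-sym) (adj-sym p≁q)

  P3Step-mono : ∀ {H K : Subgraph G} → (∀ {x y} → E H x y ≡ true → E K x y ≡ true) →
    ∀ {e f} → P3Step H e f → P3Step K e f
  P3Step-mono H⊆K (flip e)           = flip (H⊆K e)
  P3Step-mono H⊆K (p3 e f p≢q p≁q) = p3 (H⊆K e) (H⊆K f) p≢q p≁q

  P3Connected-viaHub : ∀ (H : Subgraph G) {z h} → V H z ≡ true →
    (∀ e → EdgeOf H e → Star (P3Step H) e h) →
    (∀ x → V H x ≡ true → Walk H x z) →
    P3Connected H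
  P3Connected-viaHub H {z} hz toHubEdge toHub =
    ((z , hz) , λ x y hx hy → toHub x hx ◅◅ reverse (E-flip H) (toHub y hy)) ,
    λ e f he hf → toHubEdge e he ◅◅ reverse P3Step-sym (toHubEdge f hf)

  ⊑-refl : ∀ {H : Subgraph G} → H ⊑ H
  ⊑-refl = (λ _ h → h) , (λ _ _ h → h)

  ⊑-trans : ∀ {H H' H'' : Subgraph G} → H ⊑ H' → H' ⊑ H'' → H ⊑ H''
  ⊑-trans (V⊆ , E⊆) (V⊆′ , E⊆′) = (λ x → V⊆′ x ∘ V⊆ x) , (λ x y → E⊆′ x y ∘ E⊆ x y)

  infixl 25 _∪_
  _∪_ : Subgraph G → Subgraph G → Subgraph G
  H ∪ K = record
    { V     = λ x → V H x ∨ V K x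
    ; E     = λ x y → E H x y ∨ E K x y
    ; E-sym = λ x y → cong₂ _∨_ (E-sym H x y) (E-sym K x y)
    ; E-adj = λ x y e → [ E-adj H x y , E-adj K x y ] (∨-true-elim e)
    ; E-V   = λ x y e → [ ∨-trueˡ _ ∘ E-V H x y , ∨-trueʳ _ ∘ E-V K x y ] (∨-true-elim e)
    }

  ⊑-∪ˡ : ∀ {H K : Subgraph G} → H ⊑ H ∪ K
  ⊑-∪ˡ = (λ _ → ∨-trueˡ _) , (λ _ _ → ∨-trueˡ _)

  ∪-P3Connected : ∀ {H K : Subgraph G} {s e f} → P3Connected H → P3Connected K →
    V H s ≡ true → V K s ≡ true → EdgeOf H e → EdgeOf K f → P3Step (H ∪ K) e f →
    P3Connected (H ∪ K)
  ∪-P3Connected {H} {K} {s} {e} {f} pH pK hs ks he kf bridge =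
    P3Connected-viaHub (H ∪ K) (∨-trueˡ _ hs) toHubEdge toHub
    where
      toHubEdge : ∀ g → EdgeOf (H ∪ K) g → Star (P3Step (H ∪ K)) g e
      toHubEdge g g∈ with ∨-true-elim g∈
      ... | inj₁ g∈H = map (P3Step-mono (∨-trueˡ _)) (p3-walk pH g∈H he)
      ... | inj₂ g∈K = map (P3Step-mono (∨-trueʳ _)) (p3-walk pK g∈K kf)
                       ◅◅ (P3Step-sym bridge ◅ ε)

      toHub : ∀ x → V (H ∪ K) x ≡ true → Walk (H ∪ K) x s
      toHub x x∈ with ∨-true-elim x∈
      ... | inj₁ x∈H = map (∨-trueˡ _) (walk pH x∈H hs)
      ... | inj₂ x∈K = map (∨-trueʳ _) (walk pK x∈K ks)

  module StarGraph (u : Fin n) (L : Fin n → Bool) (u~L : ∀ x → L x ≡ true → adj G u x ≡ true) where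

    star-edge-elim : ∀ {x y} → ((x == u) ∧ L y) ∨ ((y == u) ∧ L x) ≡ true →
      (x ≡ u × L y ≡ true) ⊎ (y ≡ u × L x ≡ true)
    star-edge-elim {x} {y} e with ∨-true-elim e
    ... | inj₁ s = inj₁ (==-sound {x = x} (proj₁ (∧-true-elim s)) , proj₂ (∧-true-elim s))
    ... | inj₂ s = inj₂ (==-sound {x = y} (proj₁ (∧-true-elim s)) , proj₂ (∧-true-elim s))

    star : Subgraph G
    star = record
      { V     = λ x → (x == u) ∨ L x
      ; E     = λ x y → ((x == u) ∧ L y) ∨ ((y == u) ∧ L x)
      ; E-sym = λ x y → ∨-comm ((x == u) ∧ L y) ((y == u) ∧ L x)
      ; E-adj = λ x y e → adj-spoke (star-edge-elim e)
      ; E-V   = λ x y e → V-spoke (star-edge-elim e)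
      }
      where
        adj-spoke : ∀ {x y} → (x ≡ u × L y ≡ true) ⊎ (y ≡ u × L x ≡ true) → adj G x y ≡ true
        adj-spoke (inj₁ (refl , ly)) = u~L _ ly
        adj-spoke (inj₂ (refl , lx)) = adj-sym (u~L _ lx)

        V-spoke : ∀ {x y} → (x ≡ u × L y ≡ true) ⊎ (y ≡ u × L x ≡ true) → (x == u) ∨ L x ≡ true
        V-spoke (inj₁ (refl , _)) = ∨-trueˡ _ (==-refl u)
        V-spoke (inj₂ (_ , lx))   = ∨-trueʳ _ lx

    star-centre : V star u ≡ true
    star-centre = ∨-trueˡ _ (==-refl u)

    star-leaf : ∀ x → L x ≡ true → V star x ≡ true
    star-leaf x = ∨-trueʳ (x == u)

    star-spoke : ∀ y → L y ≡ true → E star u y ≡ true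
    star-spoke y ly = ∨-trueˡ _ (∧-true-intro (==-refl u) ly)

    star-spokeʳ : ∀ y → L y ≡ true → E star y u ≡ true
    star-spokeʳ y ly = ∨-trueʳ ((y == u) ∧ L u) (∧-true-intro (==-refl u) ly)

    -- Every spoke uy is P3-adjacent to the spoke uv.
    star-P3Connected : ∀ v → L v ≡ true →
      (∀ y → L y ≡ true → y ≢ v → adj G y v ≡ false) → P3Connected star
    star-P3Connected v lv y≁v =
      P3Connected-viaHub star star-centre toHubEdge toCentre
      where
        spoke-to-uv : ∀ {y} → L y ≡ true → Star (P3Step star) (u , y) (u , v)
        spoke-to-uv {y} ly with y ≟ v
        ... | yes refl = ε
        ... | no  y≢v  = p3 (star-spoke y ly) (star-spoke v lv) y≢v (y≁v y ly y≢v) ◅ ε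

        toHubEdge : ∀ g → EdgeOf star g → Star (P3Step star) g (u , v)
        toHubEdge (x , y) e with star-edge-elim {x} {y} e
        ... | inj₁ (refl , ly) = spoke-to-uv ly
        ... | inj₂ (refl , lx) = flip e ◅ spoke-to-uv lx

        toCentre : ∀ x → V star x ≡ true → Walk star x u
        toCentre x x∈ with ∨-true-elim x∈
        ... | inj₁ x==u with ==-sound {x = x} x==u
        ...   | refl = ε
        toCentre x x∈ | inj₂ lx = star-spokeʳ x lx ◅ ε

  Absorbs : Subgraph G → Fin n → Set
  Absorbs H v = Σ (Subgraph G) λ H' → P3Connected H' × H ⊑ H' × V H' v ≡ true

  HubOver : Subgraph G → Subgraph G → Set
  HubOver H H' =
    ∃ λ u → V H' u ≡ true × ((w : Fin n) → V H w ≡ true → V H' w ≡ true)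
      × ((w : Fin n) → V H w ≡ true → E H' u w ≡ true)

  HubAbsorbs : Subgraph G → Fin n → Set
  HubAbsorbs H v = Σ (Subgraph G) λ H' → P3Connected H' × V H' v ≡ true × HubOver H H'

  Dominates : Fin n → Subgraph G → Set
  Dominates v H = (w : Fin n) → V H w ≡ true → adj G v w ≡ true

  Absorbs-antimono : ∀ {H H' : Subgraph G} {v} → H ⊑ H' → Absorbs H' v → Absorbs H v
  Absorbs-antimono {H} {H'} H⊑H' (H'' , pH'' , H'⊑H'' , v∈H'') =
    H'' , pH'' , ⊑-trans {H} {H'} {H''} H⊑H' H'⊑H'' , v∈H''

  Absorbs⇒HubAbsorbs : ∀ {H H' : Subgraph G} {v} → HubOver H H' → Absorbs H' v → HubAbsorbs H v
  Absorbs⇒HubAbsorbs (u , u∈ , V⊆ , spokes) (H'' , pH'' , (V⊆′ , E⊆′) , v∈H'') =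
    H'' , pH'' , v∈H'' , u , V⊆′ u u∈ , (λ w → V⊆′ w ∘ V⊆ w) , (λ w → E⊆′ u w ∘ spokes w)

  mixed-neighbourhood⇒Absorbs : ∀ {H : Subgraph G} {v y w} → P3Connected H →
    V H y ≡ true → adj G v y ≡ true → V H w ≡ true → adj G v w ≡ false → Absorbs H v
  mixed-neighbourhood⇒Absorbs {H} {v} {y} {w} pH hy v~y hw v≁w with V H v in v∈H
  ... | true  = H , pH , ⊑-refl {H} , v∈H
  ... | false with Star-crossing (adj G v) (walk pH hy hw) v~y v≁w
  ... | z , z' , zz' , v~z , v≁z' =
    H ∪ edge , ∪-P3Connected pH pEdge hz star-centre zz' (star-spoke v Lv) bridge ,
    ⊑-∪ˡ {H} {edge} , ∨-trueʳ (V H v) (star-leaf v Lv)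
    where
      L : Fin n → Bool
      L x = x == v

      z~L : ∀ x → L x ≡ true → adj G z x ≡ true
      z~L x x==v with ==-sound {x = x} x==v
      ... | refl = adj-sym v~z

      Lv : L v ≡ true
      Lv = ==-refl v

      open StarGraph z L z~L renaming (star to edge)

      pEdge : P3Connected edge
      pEdge = star-P3Connected v Lv (λ y y==v y≢v → ⊥-elim (y≢v (==-sound y==v)))

      hz : V H z ≡ true
      hz = E-V H z z' zz'

      z'≢v : z' ≢ v
      z'≢v refl = true≢false (E-V H z' z (E-flip H zz')) v∈H

      bridge : P3Step (H ∪ edge) (z , z') (z , v)
      bridge = p3 (∨-trueˡ _ zz') (∨-trueʳ (E H z v) (star-spoke v Lv))
                  z'≢v (adj-sym v≁z')

  dominating-neighbour⇒HubAbsorbs : ∀ {H : Subgraph G} {v x} → adj G v x ≡ true → Dominates x H →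
    (∀ w → V H w ≡ true → adj G v w ≡ false) → HubAbsorbs H v
  dominating-neighbour⇒HubAbsorbs {H} {v} {x} v~x x~H v≁H =
    star , star-P3Connected v Lv nonadj , star-leaf v Lv ,
    x , star-centre , (λ w → star-leaf w ∘ ∨-trueʳ (w == v)) , (λ w → star-spoke w ∘ ∨-trueʳ (w == v))
    where
      L : Fin n → Bool
      L y = (y == v) ∨ V H y

      Lv : L v ≡ true
      Lv = ∨-trueˡ _ (==-refl v)

      x~L : ∀ y → L y ≡ true → adj G x y ≡ true
      x~L y ly with ∨-true-elim ly
      ... | inj₂ y∈H = x~H y y∈H
      ... | inj₁ y==v with ==-sound {x = y} y==v
      ...   | refl = adj-sym v~x

      open StarGraph x L x~L

      nonadj : ∀ y → L y ≡ true → y ≢ v → adj G y v ≡ false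
      nonadj y ly y≢v with ∨-true-elim ly
      ... | inj₁ y==v = ⊥-elim (y≢v (==-sound y==v))
      ... | inj₂ y∈H  = adj-sym (v≁H y y∈H)

  trichotomy-along-walk : ∀ {H : Subgraph G} {v y} → P3Connected H →
    Star (λ a b → adj G a b ≡ true) v y → V H y ≡ true →
    Absorbs H v ⊎ HubAbsorbs H v ⊎ Dominates v H
  trichotomy-along-walk {H} pH ε hy = inj₁ (H , pH , ⊑-refl {H} , hy)
  trichotomy-along-walk {H} {v} pH (v~x ◅ rest) hy
    with any? (λ w → (V H w ≟ᵇ true) ×-dec (adj G v w ≟ᵇ false))
  ... | no noNonNeighbour = inj₂ (inj₂ λ w hw → ¬-not λ v≁w → noNonNeighbour (w , hw , v≁w))
  ... | yes (w , hw , v≁w) with any? (λ y → (V H y ≟ᵇ true) ×-dec (adj G v y ≟ᵇ true))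
  ...   | yes (y , hy′ , v~y) = inj₁ (mixed-neighbourhood⇒Absorbs pH hy′ v~y hw v≁w)
  ...   | no noNeighbour with trichotomy-along-walk pH rest hy
  ...     | inj₁ (H' , pH' , H⊑H' , x∈H') =
              inj₁ (Absorbs-antimono {H} {H'} H⊑H'
                     (mixed-neighbourhood⇒Absorbs {H'} pH' x∈H' v~x (proj₁ H⊑H' w hw) v≁w))
  ...     | inj₂ (inj₁ (H' , pH' , x∈H' , hub@(_ , _ , V⊆ , _))) =
              inj₂ (inj₁ (Absorbs⇒HubAbsorbs {H} {H'} hub
                          (mixed-neighbourhood⇒Absorbs {H'} pH' x∈H' v~x (V⊆ w hw) v≁w)))
  ...     | inj₂ (inj₂ x~H) =
              inj₂ (inj₁ (dominating-neighbour⇒HubAbsorbs {H} v~x x~H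
                          λ w hw → ¬-not λ v~w → noNeighbour (w , hw , v~w)))

theorem4p2 : ∀ {n} (G : Graph n) → Connected G →
    (H : Subgraph G) → P3Connected H → (v : Fin n) →
    (Σ (Subgraph G) λ H' → P3Connected H' × H ⊑ H' × V H' v ≡ true)
    ⊎ (Σ (Subgraph G) λ H' → P3Connected H' × V H' v ≡ true ×
        ∃ λ u → V H' u ≡ true × ((w : Fin n) → V H w ≡ true → V H' w ≡ true)
          × ((w : Fin n) → V H w ≡ true → E H' u w ≡ true))
    ⊎ ((w : Fin n) → V H w ≡ true → adj G v w ≡ true)
theorem4p2 G connected H pH v =
  let (y , y∈H) = proj₁ (proj₁ pH) in
  trichotomy-along-walk G pH (connected v y) y∈H
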